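{- Let $A$ be an $n\times m$ $0,1$-matrix and $B$ a $p\times q$ $0,1$-matrix. Suppose that there exist two families of $0,1$-matrices, $\mathcal{M}=\{M_1,\ldots,M_s\}$ (each of size $n\times m$) and $\mathcal{N}=\{N_1,\ldots,N_s\}$ (each of size $p\times q$), such that (1) $\mathcal{M}$ is a cover of $A$, and (2) for every $i,j$ such that $A_{i,j}=1$, the matrices $N_t$ for which $(M_t)_{i,j}=1$ form a cover of $B$. Then $\mathrm{R}_{\mathbb{B}}(A\otimes B)\le \sum_{t=1}^{s}\mathrm{R}_{\mathbb{B}}(M_t)\cdot \mathrm{R}_{\mathbb{B}}(N_t)$.
   Context: The Boolean rank $\mathrm{R}_{\mathbb{B}}(A)$ of a $0,1$-matrix $A$ is the smallest number of combinatorial rectangles $X\times Y$ (sets of row indices times sets of column indices) with all entries of $A$ in them equal to $1$, needed to cover all $1$-entries of $A$; equivalently, the smallest $k$ with $A=UV$ for $0,1$-matrices $U,V$ of inner dimension $k$ under Boolean arithmetic ($1+1=1$). The zero matrix has Boolean rank $0$. A collection $\{M_1,\ldots,M_s\}$ of $0,1$-matrices of the same size as $A$ is a cover of $A$ if for every $i,j$: $A_{i,j}=1$ if and only if $(M_t)_{i,j}=1$ for some $t$ (i.e. $A$ is their Boolean sum). The Kronecker product $A\otimes B$ is the block matrix whose $(i,j)$-th block is $A_{i,j}\cdot B$. -}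

module Defs where

open import Data.Nat using (ℕ; zero; suc; _+_; _*_; _≤_)
open import Data.Fin using (Fin; remQuot)
open import Data.Bool using (Bool; true; false; _∧_)
open import Data.Product using (Σ; ∃; _×_; _,_; proj₁; proj₂)
open import Relation.Binary.PropositionalEquality using (_≡_)
open import Function.Bundles using (_⇔_)

Matrix : ℕ → ℕ → Set
Matrix n m = Fin n → Fin m → Bool

-- A family of k combinatorial rectangles X_t × Y_t (row set, column set),
-- given by characteristic functions.
record Rects (n m k : ℕ) : Set where
  field
    rows : Fin k → Fin n → Bool
    cols : Fin k → Fin m → Bool

open Rects public

RectCover : ∀ {n m} (A : Matrix n m) (k : ℕ) → Set
RectCover {n} {m} A k =
  Σ (Rects n m k) λ R → ∀ i j →
    (A i j ≡ true) ⇔ (∃ λ (t : Fin k) → (rows R t i ∧ cols R t j) ≡ true)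

BoolRank : ∀ {n m} (A : Matrix n m) (r : ℕ) → Set
BoolRank A r = RectCover A r × (∀ k → RectCover A k → r ≤ k)

-- A family of matrices indexed by I is a cover of A: A is their Boolean sum.
-- (Used with I = Fin s, and with sub-families I = Σ (Fin s) P.)
IsCover : ∀ {n m} {I : Set} (A : Matrix n m) (M : I → Matrix n m) → Set
IsCover {I = I} A M = ∀ i j → (A i j ≡ true) ⇔ (∃ λ (t : I) → M t i j ≡ true)

-- Kronecker product A ⊗ B; row (i,k) is index i * p + k (Data.Fin.combine).
_⊗_ : ∀ {n m p q} → Matrix n m → Matrix p q → Matrix (n * p) (m * q)
_⊗_ {p = p} {q = q} A B r c =
  let (i , k) = remQuot p r
      (j , l) = remQuot q c
  in A i j ∧ B k l

sumFin : ∀ s → (Fin s → ℕ) → ℕ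
sumFin zero    f = 0
sumFin (suc s) f = f Fin.zero + sumFin s (λ t → f (Fin.suc t))

-- Since A is the Boolean sum of the M t and, on the support of A, B is the Boolean sum of the
-- N t with (M t) i j = 1, the Kronecker product A ⊗ B is the Boolean sum of the M t ⊗ N t.
-- A rectangle cover of M ⊗ N is obtained from covers of M and N by taking the Kronecker
-- products of their rectangles, so R_B(M t ⊗ N t) ≤ R_B(M t) · R_B(N t); and the union of
-- rectangle covers of the summands of a Boolean sum covers the sum.
module Submission where

open import Defs
open import Data.Nat using (ℕ; suc; _*_; _≤_)
open import Data.Fin using (Fin; remQuot; combine; splitAt; _↑ˡ_; _↑ʳ_)
open import Data.Fin.Properties using (remQuot-combine; splitAt-↑ˡ; splitAt-↑ʳ)
open import Data.Bool using (Bool; true; _∧_)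
open import Data.Bool.Properties using (∧-conicalˡ; ∧-conicalʳ; ∧-commutativeMonoid)
open import Data.Sum using ([_,_]′)
open import Data.Product using (Σ; ∃; _×_; _,_; proj₁; proj₂; uncurry)
open import Function using (_∘_)
open import Function.Bundles using (_⇔_; mk⇔; Equivalence)
open import Relation.Binary.PropositionalEquality using (_≡_; refl; cong₂; subst; sym; trans)
open import Algebra.Bundles using (CommutativeMonoid)
open import Algebra.Properties.CommutativeSemigroup
  (CommutativeMonoid.commutativeSemigroup ∧-commutativeMonoid) using (interchange)

open Equivalence using (to; from)

∧≡true⇔ : ∀ {x y} → (x ∧ y ≡ true) ⇔ (x ≡ true × y ≡ true)
∧≡true⇔ = mk⇔ (λ e → ∧-conicalˡ _ _ e , ∧-conicalʳ _ _ e) (uncurry (cong₂ _∧_))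

-- RectCover A k is the case I = Fin k, with X = rows R and Y = cols R.
IsRectCover : ∀ {n m} {I : Set} (A : Matrix n m) → (I → Fin n → Bool) → (I → Fin m → Bool) → Set
IsRectCover A X Y = ∀ i j → (A i j ≡ true) ⇔ (∃ λ u → (X u i ∧ Y u j) ≡ true)

rectCover-reindex : ∀ {n m k} {I : Set} {A : Matrix n m} (X : I → Fin n → Bool) (Y : I → Fin m → Bool)
  (g : Fin k → I) (h : I → Fin k) → (∀ u → g (h u) ≡ u) →
  IsRectCover A X Y → RectCover A k
rectCover-reindex X Y g h g∘h≗id cover =
  record { rows = X ∘ g ; cols = Y ∘ g } , λ i j → mk⇔
    (λ e → let (u , eu) = to (cover i j) e
           in h u , subst (λ v → (X v i ∧ Y v j) ≡ true) (sym (g∘h≗id u)) eu)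
    (λ (v , ev) → from (cover i j) (g v , ev))

_⊗ᵛ_ : ∀ {n p} → (Fin n → Bool) → (Fin p → Bool) → Fin (n * p) → Bool
_⊗ᵛ_ {p = p} x y r = let (i , k) = remQuot p r in x i ∧ y k

isRectCover-⊗ : ∀ {n m p q} {I J : Set} {M : Matrix n m} {N : Matrix p q}
  {X : I → Fin n → Bool} {Y : I → Fin m → Bool} {X′ : J → Fin p → Bool} {Y′ : J → Fin q → Bool} →
  IsRectCover M X Y → IsRectCover N X′ Y′ →
  IsRectCover (M ⊗ N) (λ (u , v) → X u ⊗ᵛ X′ v) (λ (u , v) → Y u ⊗ᵛ Y′ v)
isRectCover-⊗ {n} {m} {p} {q} {X = X} {Y} {X′} {Y′} coverM coverN r c = mk⇔
  (λ e → let (eM , eN) = to ∧≡true⇔ e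
             (u , eu) = to (coverM i j) eM
             (v , ev) = to (coverN k l) eN
         in (u , v) , trans (product-of-rectangles u v) (cong₂ _∧_ eu ev))
  (λ ((u , v) , e) → let (eu , ev) = to ∧≡true⇔ (trans (sym (product-of-rectangles u v)) e)
                     in cong₂ _∧_ (from (coverM i j) (u , eu)) (from (coverN k l) (v , ev)))
  where
  i = proj₁ (remQuot {n} p r)
  k = proj₂ (remQuot {n} p r)
  j = proj₁ (remQuot {m} q c)
  l = proj₂ (remQuot {m} q c)
  product-of-rectangles : ∀ u v →
    ((X u ⊗ᵛ X′ v) r ∧ (Y u ⊗ᵛ Y′ v) c) ≡ ((X u i ∧ Y u j) ∧ (X′ v k ∧ Y′ v l))
  product-of-rectangles u v = sym (interchange (X u i) (Y u j) (X′ v k) (Y′ v l))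

rectCover-⊗ : ∀ {n m p q a b} {M : Matrix n m} {N : Matrix p q} →
  RectCover M a → RectCover N b → RectCover (M ⊗ N) (a * b)
rectCover-⊗ {b = b} (R , coverM) (S , coverN) =
  rectCover-reindex (λ (u , v) → rows R u ⊗ᵛ rows S v) (λ (u , v) → cols R u ⊗ᵛ cols S v)
    (remQuot b) (uncurry combine) (λ (u , v) → remQuot-combine u v)
    (isRectCover-⊗ {X = rows R} {cols R} {rows S} {cols S} coverM coverN)

isRectCover-Σ : ∀ {n m} {I : Set} {J : I → Set} {A : Matrix n m} {M : I → Matrix n m}
  {X : ∀ t → J t → Fin n → Bool} {Y : ∀ t → J t → Fin m → Bool} →
  IsCover A M → (∀ t → IsRectCover (M t) (X t) (Y t)) → IsRectCover A (uncurry X) (uncurry Y)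
isRectCover-Σ coverA coverM i j = mk⇔
  (λ e → let (t , et) = to (coverA i j) e
             (u , eu) = to (coverM t i j) et
         in (t , u) , eu)
  (λ ((t , u) , e) → from (coverA i j) (t , from (coverM t i j) (u , e)))

sumFin-split : ∀ s (k : Fin s → ℕ) → Fin (sumFin s k) → Σ (Fin s) (Fin ∘ k)
sumFin-split (suc s) k x =
  [ (Fin.zero ,_) , (λ y → let (t , z) = sumFin-split s (k ∘ Fin.suc) y in Fin.suc t , z) ]′
    (splitAt (k Fin.zero) x)

sumFin-join : ∀ s (k : Fin s → ℕ) → Σ (Fin s) (Fin ∘ k) → Fin (sumFin s k)
sumFin-join (suc s) k (Fin.zero  , z) = z ↑ˡ sumFin s (k ∘ Fin.suc)
sumFin-join (suc s) k (Fin.suc t , z) = k Fin.zero ↑ʳ sumFin-join s (k ∘ Fin.suc) (t , z)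

sumFin-split-join : ∀ s (k : Fin s → ℕ) u → sumFin-split s k (sumFin-join s k u) ≡ u
sumFin-split-join (suc s) k (Fin.zero , z)
  rewrite splitAt-↑ˡ (k Fin.zero) z (sumFin s (k ∘ Fin.suc)) = refl
sumFin-split-join (suc s) k (Fin.suc t , z)
  rewrite splitAt-↑ʳ (k Fin.zero) (sumFin s (k ∘ Fin.suc)) (sumFin-join s (k ∘ Fin.suc) (t , z))
        | sumFin-split-join s (k ∘ Fin.suc) (t , z) = refl

rectCover-sumFin : ∀ {n m s} {A : Matrix n m} {M : Fin s → Matrix n m} {k : Fin s → ℕ} →
  IsCover A M → (∀ t → RectCover (M t) (k t)) → RectCover A (sumFin s k)
rectCover-sumFin {s = s} {k = k} coverA coverM =
  rectCover-reindex (uncurry (rows ∘ proj₁ ∘ coverM)) (uncurry (cols ∘ proj₁ ∘ coverM))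
    (sumFin-split s k) (sumFin-join s k) (sumFin-split-join s k)
    (isRectCover-Σ {X = rows ∘ proj₁ ∘ coverM} {Y = cols ∘ proj₁ ∘ coverM} coverA (proj₂ ∘ coverM))

isCover-⊗ : ∀ {n m p q s} {A : Matrix n m} {B : Matrix p q}
  {M : Fin s → Matrix n m} {N : Fin s → Matrix p q} →
  IsCover A M →
  (∀ i j → A i j ≡ true → IsCover B (λ (u : Σ (Fin s) (λ t → M t i j ≡ true)) → N (proj₁ u))) →
  IsCover (A ⊗ B) (λ t → M t ⊗ N t)
isCover-⊗ {n} {m} {p} {q} coverA coverB r c = mk⇔
  (λ e → let (eA , eB) = to ∧≡true⇔ e
             ((t , et) , eN) = to (coverB i j eA k l) eB
         in t , cong₂ _∧_ et eN)
  (λ (t , e) → let (eM , eN) = to ∧≡true⇔ e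
                   eA = from (coverA i j) (t , eM)
               in cong₂ _∧_ eA (from (coverB i j eA k l) ((t , eM) , eN)))
  where
  i = proj₁ (remQuot {n} p r)
  k = proj₂ (remQuot {n} p r)
  j = proj₁ (remQuot {m} q c)
  l = proj₂ (remQuot {m} q c)

theorem1 : ∀ {n m p q s} (A : Matrix n m) (B : Matrix p q)
    (M : Fin s → Matrix n m) (N : Fin s → Matrix p q) →
    IsCover A M →
    (∀ i j → A i j ≡ true →
      IsCover B (λ (u : Σ (Fin s) (λ t → M t i j ≡ true)) → N (Σ.proj₁ u))) →
    ∀ (rM rN : Fin s → ℕ) (r : ℕ) →
    (∀ t → BoolRank (M t) (rM t)) →
    (∀ t → BoolRank (N t) (rN t)) →
    BoolRank (A ⊗ B) r →
    r ≤ sumFin s (λ t → rM t * rN t)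
theorem1 _ _ _ _ coverA coverB _ _ _ rankM rankN (_ , minimal) =
  minimal _ (rectCover-sumFin (isCover-⊗ coverA coverB)
                              (λ t → rectCover-⊗ (proj₁ (rankM t)) (proj₁ (rankN t))))
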